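{- Let $G=(V,E)$ be a connected graph with at least two vertices and minimum degree $\delta(G)\ge\frac12(|V|-1)$. If $G$ has exactly one vertex $u$ of eccentricity $1$, then $\partial G=V\setminus\{u\}$; otherwise $\partial G=V$. Furthermore, the bound $\frac12(|V|-1)$ is sharp: for $n\ge2$ the $n$-barbell graph (two disjoint copies of $K_n$ joined by a single edge) has minimum degree $\frac12|V|-1$, no vertex of eccentricity $1$, and $\partial G\ne V$.
   Context: Graphs are finite, simple, undirected; $d$ is the shortest-path distance, $\operatorname{ecc}(v)=\max_{w\in V}d(v,w)$. For a connected graph $G=(V,E)$, the Steinerberger boundary is $\partial G=\{v\in V:\ \exists u\in V \text{ with } \frac{1}{\deg(v)}\sum_{w\in N(v)} d(w,u)<d(v,u)\}$ (with $\partial G=V$ if $|V|=1$). -}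

module Defs where

open import Data.Nat using (ℕ; zero; suc; _+_; _*_; _∸_; _<_; _≤_; _<ᵇ_; _⊔_)
open import Data.Nat.Properties using (_≟_; 1+n≢n)
open import Data.Bool using (Bool; true; false; T; _∧_; _∨_; not; if_then_else_)
open import Data.Fin using (Fin; toℕ)
import Data.Fin as F
open import Data.List using (List; length; map; foldr; allFin; filterᵇ)
open import Data.Bool.ListAction using (any)
open import Data.Nat.ListAction using (sum)
open import Data.Product using (Σ; ∃; _×_; _,_)
open import Data.Sum using (_⊎_)
open import Relation.Binary.PropositionalEquality using (_≡_; refl; sym; trans; cong; cong₂)
open import Data.Empty using (⊥; ⊥-elim)
import Data.Bool as B
import Data.Nat
open import Relation.Nullary using (¬_; does; yes; no)

record Graph (n : ℕ) : Set where
  field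
    adj     : Fin n → Fin n → Bool
    adj-sym : ∀ u v → adj u v ≡ adj v u
    adj-irrefl : ∀ v → adj v v ≡ false
open Graph public

module _ {n : ℕ} (G : Graph n) where

  vertices : List (Fin n)
  vertices = allFin n

  nbrs : Fin n → List (Fin n)
  nbrs v = filterᵇ (adj G v) vertices

  deg : Fin n → ℕ
  deg v = length (nbrs v)

  data Walk : Fin n → Fin n → ℕ → Set where
    here : ∀ {u} → Walk u u 0
    step : ∀ {u w v k} → T (adj G u w) → Walk w v k → Walk u v (suc k)

  Connected : Set
  Connected = ∀ u v → ∃ λ k → Walk u v k

  reachWithin : ℕ → Fin n → Fin n → Bool
  reachWithin zero    u v = does (toℕ u ≟ toℕ v)
  reachWithin (suc k) u v =
    reachWithin k u v ∨ any (λ w → adj G u w ∧ reachWithin k w v) vertices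

  private
    search : ℕ → ℕ → Fin n → Fin n → ℕ
    search zero       start u v = start
    search (suc fuel) start u v =
      if reachWithin start u v then start else search fuel (suc start) u v

  -- shortest-path distance d(u,v): least length of a walk from u to v
  -- (in a connected graph on n vertices this is < n, so the search is exhaustive)
  dist : Fin n → Fin n → ℕ
  dist u v = search n 0 u v

  ecc : Fin n → ℕ
  ecc v = foldr _⊔_ 0 (map (dist v) vertices)

  -- Steinerberger boundary, with denominators cleared:
  --   (1/deg v) Σ_{w ∈ N(v)} d(w,u) < d(v,u)  ⟺  Σ_{w ∈ N(v)} d(w,u) < deg v * d(v,u)
  -- and the convention ∂G = V when |V| = 1.
  InBoundary : Fin n → Set
  InBoundary v = (n ≡ 1) ⊎
    (∃ λ u → sum (map (λ w → dist w u) (nbrs v)) < deg v * dist v u)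

eqᵇ : ℕ → ℕ → Bool
eqᵇ = Data.Nat._≡ᵇ_

eqᵇ-sym : ∀ a b → eqᵇ a b ≡ eqᵇ b a
eqᵇ-sym zero    zero    = refl
eqᵇ-sym zero    (suc b) = refl
eqᵇ-sym (suc a) zero    = refl
eqᵇ-sym (suc a) (suc b) = eqᵇ-sym a b

eqᵇ-refl : ∀ a → eqᵇ a a ≡ true
eqᵇ-refl zero    = refl
eqᵇ-refl (suc a) = eqᵇ-refl a

-- the m-barbell graph on Fin (m + m): vertices with toℕ < m form one K_m,
-- the others form a second K_m, and the single bridge edge joins m-1 and m.
sameSide : (m : ℕ) → ℕ → ℕ → Bool
sameSide m a b = does ((a <ᵇ m) B.≟ (b <ᵇ m))

barbellAdj : (m : ℕ) → Fin (m + m) → Fin (m + m) → Bool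
barbellAdj m i j =
  (not (eqᵇ (toℕ i) (toℕ j)) ∧ sameSide m (toℕ i) (toℕ j))
  ∨ ((eqᵇ (suc (toℕ i)) m ∧ eqᵇ (toℕ j) m) ∨ (eqᵇ (suc (toℕ j)) m ∧ eqᵇ (toℕ i) m))

private
  ≡ᵇ-sym : ∀ x y → does (x B.≟ y) ≡ does (y B.≟ x)
  ≡ᵇ-sym false false = refl
  ≡ᵇ-sym false true  = refl
  ≡ᵇ-sym true  false = refl
  ≡ᵇ-sym true  true  = refl

  ∨-comm : ∀ x y → (x ∨ y) ≡ (y ∨ x)
  ∨-comm false false = refl
  ∨-comm false true  = refl
  ∨-comm true  false = refl
  ∨-comm true  true  = refl

barbell : (m : ℕ) → Graph (m + m)
barbell m = record
  { adj = barbellAdj m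
  ; adj-sym = λ i j → cong₂ _∨_
      (cong₂ _∧_ (cong not (eqᵇ-sym (toℕ i) (toℕ j))) (≡ᵇ-sym (toℕ i <ᵇ m) (toℕ j <ᵇ m)))
      (∨-comm (eqᵇ (suc (toℕ i)) m ∧ eqᵇ (toℕ j) m) (eqᵇ (suc (toℕ j)) m ∧ eqᵇ (toℕ i) m))
  ; adj-irrefl = irr
  }
  where
  both : ∀ a k → (eqᵇ (suc a) k ∧ eqᵇ a k) ≡ false
  both a       zero          = refl
  both zero    (suc zero)    = refl
  both zero    (suc (suc k)) = refl
  both (suc a) (suc k)       = both a k

  irr : ∀ i → barbellAdj m i i ≡ false
  irr i rewrite eqᵇ-refl (toℕ i) | both (toℕ i) m = refl

module Submission where

-- Under δ(G) ≥ (n - 1)/2 two non-adjacent vertices u, v have a common neighbour, since otherwise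
-- N(u), N(v) and {u} would be disjoint subsets of V ∖ {v}; hence every distance is at most 2.
-- A vertex v with a non-neighbour w lies in ∂G: d(v, w) = 2, every neighbour of v is within 2
-- of w and their common neighbour within 1. A universal vertex v (the same as ecc v = 1) has
-- V ∖ {v} as neighbourhood, and a witness x is then a neighbour, at distance 1: the mean
-- distance of N(v) to x is below 1 exactly when x is universal as well, for otherwise a
-- non-neighbour of x contributes 2 and compensates the 0 contributed by x itself.
-- In the barbell the end bₗ of the bridge is not in ∂G: for a neighbour x of bₗ, some other
-- neighbour of bₗ is not adjacent to x and compensates x in the same way; for a non-neighbour x
-- of bₗ, the other end of the bridge is at distance 1 from x, the vertex 0 at distance 3, and all
-- remaining neighbours of bₗ at distance at least 2 = d(bₗ, x).

open import Defs
open import Data.Bool using (Bool; true; false; T; not; _∧_; _∨_; if_then_else_)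
import Data.Bool as B
open import Data.Bool.Properties using (T-∧; T-∨; T-≡; T-not-≡)
open import Data.Empty using (⊥-elim)
open import Data.Fin using (Fin; toℕ; zero; suc; punchIn; fromℕ<)
import Data.Fin as F
open import Data.Fin.Properties using (toℕ-injective; toℕ-fromℕ<; toℕ<n; punchInᵢ≢i; any?; all?; ¬∀⟶∃¬)
open import Data.List using ([]; _∷_; length; map; foldr; filterᵇ; allFin; tabulate)
open import Data.List.Membership.Propositional using (_∈_; lose; find)
open import Data.List.Membership.Propositional.Properties using (∈-filter⁺; ∈-filter⁻; ∈-allFin)
open import Data.List.Properties using (filter-some; filter-notAll; length-tabulate)
import Data.List.Relation.Unary.All as All
open import Data.List.Relation.Unary.AllPairs using (_∷_)
open import Data.List.Relation.Unary.Any using (here; there)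
open import Data.List.Relation.Unary.Any.Properties using (any⁺; any⁻)
open import Data.List.Relation.Unary.Unique.Propositional using (Unique)
open import Data.List.Relation.Unary.Unique.Propositional.Properties using (allFin⁺; filter⁺)
open import Data.Nat
  using (ℕ; zero; suc; _+_; _*_; _∸_; _⊔_; _⊓_; _≤_; _<_; _<ᵇ_; _<?_; z≤n; s≤s; z<s; _≤′_; ≤′-refl; ≤′-step)
open import Data.Nat.ListAction using (sum)
open import Data.Nat.Properties
open import Data.Nat.Tactic.RingSolver using (solve-∀)
open import Data.Product using (∃; _×_; _,_; proj₁; proj₂)
open import Data.Sum using (_⊎_; inj₁; inj₂; [_,_]′; map₂)
open import Data.Unit using (tt)
open import Function using (_∘_; id; case_of_)
open import Function.Bundles using (Equivalence; _⇔_; mk⇔)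
open import Relation.Binary.PropositionalEquality
  using (_≡_; _≢_; refl; sym; trans; cong; cong₂; subst; ≢-sym; module ≡-Reasoning)
open import Relation.Nullary using (¬_; Dec; yes; no; isYes)
open import Relation.Nullary.Decidable
  using (T?; map′; ¬?; _→-dec_; _×-dec_; toWitness; fromWitness; dec-true; dec-false)

open Equivalence using (to; from)

module _ {A : Set} (f : A → ℕ) where

  length*≤sum : ∀ {k} xs → (∀ {w} → w ∈ xs → k ≤ f w) → length xs * k ≤ sum (map f xs)
  length*≤sum []       _  = z≤n
  length*≤sum (a ∷ as) lb = +-mono-≤ (lb (here refl)) (length*≤sum as (λ w∈ → lb (there w∈)))

  sum≤length* : ∀ {k} xs → (∀ {w} → w ∈ xs → f w ≤ k) → sum (map f xs) ≤ length xs * k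
  sum≤length* []       _  = z≤n
  sum≤length* (a ∷ as) ub = +-mono-≤ (ub (here refl)) (sum≤length* as (λ w∈ → ub (there w∈)))

  sum<length* : ∀ {k y} xs → (∀ {w} → w ∈ xs → f w ≤ k) → y ∈ xs → f y < k →
                sum (map f xs) < length xs * k
  sum<length* (a ∷ as) ub (here refl) fy<k = +-mono-<-≤ fy<k (sum≤length* as (λ w∈ → ub (there w∈)))
  sum<length* (a ∷ as) ub (there y∈) fy<k =
    +-mono-≤-< (ub (here refl)) (sum<length* as (λ w∈ → ub (there w∈)) y∈ fy<k)

  length*≤sum-except : ∀ {k y} xs → Unique xs → y ∈ xs → (∀ {w} → w ∈ xs → w ≢ y → k ≤ f w) →
                       length xs * k + f y ≤ sum (map f xs) + k
  length*≤sum-except {k} (a ∷ as) (a∉ ∷ _) (here refl) lb = begin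
    k + length as * k + f a   ≡⟨ +-comm-outer k _ (f a) ⟩
    f a + length as * k + k   ≤⟨ +-monoˡ-≤ k (+-monoʳ-≤ (f a) rest) ⟩
    f a + sum (map f as) + k  ∎
    where
    open ≤-Reasoning
    +-comm-outer : ∀ a b c → a + b + c ≡ c + b + a
    +-comm-outer = solve-∀
    rest = length*≤sum as (λ w∈ → lb (there w∈) (≢-sym (All.lookup a∉ w∈)))
  length*≤sum-except {k} {y} (a ∷ as) (a∉ ∷ u) (there y∈) lb = begin
    k + length as * k + f y    ≡⟨ +-assoc k _ (f y) ⟩
    k + (length as * k + f y)  ≤⟨ +-mono-≤ (lb (here refl) (All.lookup a∉ y∈))
                                    (length*≤sum-except as u y∈ (λ w∈ → lb (there w∈))) ⟩
    f a + (sum (map f as) + k) ≡⟨ +-assoc (f a) _ k ⟨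
    f a + sum (map f as) + k   ∎
    where open ≤-Reasoning

  private
    head-avoided : ∀ {a w : A} {as} → Unique (a ∷ as) → w ∈ as → w ≢ a
    head-avoided (a∉ ∷ _) w∈ = ≢-sym (All.lookup a∉ w∈)

    pair-at-head : ∀ {k a y} as → Unique (a ∷ as) → y ∈ as → k + k ≤ f a + f y →
                   (∀ {w} → w ∈ as → w ≢ y → k ≤ f w) → k + length as * k ≤ f a + sum (map f as)
    pair-at-head {k} {a} {y} as (_ ∷ u) y∈ k+k≤ lb = +-cancelʳ-≤ (f y + k) _ _ (begin
      k + length as * k + (f y + k)        ≡⟨ regroup₁ k _ (f y) ⟩
      (k + k) + (length as * k + f y)      ≤⟨ +-mono-≤ k+k≤ (length*≤sum-except as u y∈ lb) ⟩
      (f a + f y) + (sum (map f as) + k)   ≡⟨ regroup₂ (f a) (f y) _ k ⟩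
      f a + sum (map f as) + (f y + k)     ∎)
      where
      open ≤-Reasoning
      regroup₁ : ∀ k l y → k + l + (y + k) ≡ (k + k) + (l + y)
      regroup₁ = solve-∀
      regroup₂ : ∀ a y s k → (a + y) + (s + k) ≡ a + s + (y + k)
      regroup₂ = solve-∀

  length*≤sum-pair : ∀ {k x y} xs → Unique xs → x ∈ xs → y ∈ xs → x ≢ y → k + k ≤ f x + f y →
                     (∀ {w} → w ∈ xs → w ≢ x → w ≢ y → k ≤ f w) → length xs * k ≤ sum (map f xs)
  length*≤sum-pair (a ∷ as) _  (here refl) (here refl) x≢y _ _ = ⊥-elim (x≢y refl)
  length*≤sum-pair (a ∷ as) u  (here refl) (there y∈) _ k+k≤ lb =
    pair-at-head as u y∈ k+k≤ (λ w∈ w≢y → lb (there w∈) (head-avoided u w∈) w≢y)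
  length*≤sum-pair {k} {x} {y} (a ∷ as) u (there x∈) (here refl) _ k+k≤ lb =
    pair-at-head as u x∈ (subst (k + k ≤_) (+-comm (f x) (f y)) k+k≤)
      (λ w∈ w≢x → lb (there w∈) w≢x (head-avoided u w∈))
  length*≤sum-pair (a ∷ as) (a∉ ∷ u) (there x∈) (there y∈) x≢y k+k≤ lb =
    +-mono-≤ (lb (here refl) (All.lookup a∉ x∈) (All.lookup a∉ y∈))
             (length*≤sum-pair as u x∈ y∈ x≢y k+k≤ (λ w∈ → lb (there w∈)))

  ≤-foldr-⊔ : ∀ {x} xs → x ∈ xs → f x ≤ foldr _⊔_ 0 (map f xs)
  ≤-foldr-⊔ (y ∷ xs) (here refl) = m≤m⊔n (f y) _
  ≤-foldr-⊔ (y ∷ xs) (there x∈)  = ≤-trans (≤-foldr-⊔ xs x∈) (m≤n⊔m (f y) _)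

  foldr-⊔-≤ : ∀ {k} xs → (∀ {x} → x ∈ xs → f x ≤ k) → foldr _⊔_ 0 (map f xs) ≤ k
  foldr-⊔-≤ []       _  = z≤n
  foldr-⊔-≤ (y ∷ xs) ub = ⊔-lub (ub (here refl)) (foldr-⊔-≤ xs (λ x∈ → ub (there x∈)))

length-filterᵇ-∨ : ∀ {A : Set} (p q : A → Bool) → (∀ x → T (p x) → ¬ T (q x)) → ∀ xs →
                   length (filterᵇ (λ x → p x ∨ q x) xs) ≡ length (filterᵇ p xs) + length (filterᵇ q xs)
length-filterᵇ-∨ p q disjoint [] = refl
length-filterᵇ-∨ p q disjoint (x ∷ xs) with p x in px | q x in qx
... | true  | true  = ⊥-elim (disjoint x (subst T (sym px) tt) (subst T (sym qx) tt))
... | true  | false = cong suc (length-filterᵇ-∨ p q disjoint xs)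
... | false | true  = trans (cong suc (length-filterᵇ-∨ p q disjoint xs)) (sym (+-suc _ _))
... | false | false = length-filterᵇ-∨ p q disjoint xs

sum-of-halves : ∀ {n a b} → n ≤ 2 * a + 1 → n ≤ 2 * b + 1 → n ≤ a + b + 1
sum-of-halves {n} {a} {b} n≤2a+1 n≤2b+1 = *-cancelˡ-≤ 2 (begin
  2 * n                   ≡⟨ double n ⟩
  n + n                   ≤⟨ +-mono-≤ n≤2a+1 n≤2b+1 ⟩
  2 * a + 1 + (2 * b + 1) ≡⟨ regroup a b ⟩
  2 * (a + b + 1)         ∎)
  where
  open ≤-Reasoning
  double : ∀ n → 2 * n ≡ n + n
  double = solve-∀
  regroup : ∀ a b → 2 * a + 1 + (2 * b + 1) ≡ 2 * (a + b + 1)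
  regroup = solve-∀

T-not⁺ : ∀ {b} → ¬ T b → T (not b)
T-not⁺ {false} _  = tt
T-not⁺ {true}  ¬t = ¬t tt

count : (ℕ → Bool) → ℕ → ℕ
count p zero    = 0
count p (suc k) = (if p 0 then 1 else 0) + count (p ∘ suc) k

length-filterᵇ-tabulate : ∀ {A : Set} {k} (q : A → Bool) (f : Fin k → A) (p : ℕ → Bool) →
                          (∀ i → q (f i) ≡ p (toℕ i)) → length (filterᵇ q (tabulate f)) ≡ count p k
length-filterᵇ-tabulate {k = zero}  q f p _  = refl
length-filterᵇ-tabulate {k = suc k} q f p eq with q (f zero) | p 0 | eq zero
... | true  | true  | _ = cong suc (length-filterᵇ-tabulate q (f ∘ suc) (p ∘ suc) (eq ∘ suc))
... | false | false | _ = length-filterᵇ-tabulate q (f ∘ suc) (p ∘ suc) (eq ∘ suc)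

count-+ : ∀ p a b → count p (a + b) ≡ count p a + count (λ i → p (a + i)) b
count-+ p zero    b = refl
count-+ p (suc a) b = trans (cong (head +_) (count-+ (p ∘ suc) a b)) (sym (+-assoc head _ _))
  where head = if p 0 then 1 else 0

count-all : ∀ p k → (∀ {i} → i < k → T (p i)) → count p k ≡ k
count-all p zero    _   = refl
count-all p (suc k) all with p 0 in p0
... | true  = cong suc (count-all (p ∘ suc) k (all ∘ s≤s))
... | false = ⊥-elim (subst T p0 (all z<s))

count-none : ∀ p k → (∀ {i} → i < k → ¬ T (p i)) → count p k ≡ 0
count-none p zero    _    = refl
count-none p (suc k) none with p 0 in p0
... | true  = ⊥-elim (none z<s (subst T (sym p0) tt))
... | false = count-none (p ∘ suc) k (none ∘ s≤s)

count-except : ∀ p k a → (∀ {i} → i < k → i ≢ a → T (p i)) → k ≤ suc (count p k)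
count-except p zero    a       _   = z≤n
count-except p (suc k) zero    all =
  s≤s (subst (_≤ (if p 0 then 1 else 0) + count (p ∘ suc) k)
             (count-all (p ∘ suc) k (λ i<k → all (s≤s i<k) (λ ())))
             (m≤n+m _ (if p 0 then 1 else 0)))
count-except p (suc k) (suc a) all with p 0 in p0
... | true  = s≤s (count-except (p ∘ suc) k a (λ i<k i≢a → all (s≤s i<k) (i≢a ∘ suc-injective)))
... | false = ⊥-elim (subst T p0 (all z<s (λ ())))

firstTrue : (ℕ → Bool) → ℕ → ℕ → ℕ → ℕ
firstTrue p zero    s x = x
firstTrue p (suc d) s x = if p s then s else firstTrue p d (suc s) x

firstTrue≤ : ∀ p d {s x k} → (s + d ≤ k → x ≤ k) → s ≤ k → T (p k) → firstTrue p d s x ≤ k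
firstTrue≤ p zero    {s} {k = k} x≤k s≤k _ = x≤k (subst (_≤ k) (sym (+-identityʳ s)) s≤k)
firstTrue≤ p (suc d) {s} {k = k} x≤k s≤k pk with p s in ps
... | true  = s≤k
... | false = firstTrue≤ p d (λ le → x≤k (subst (_≤ k) (sym (+-suc s d)) le)) (≤∧≢⇒< s≤k s≢k) pk
  where
  s≢k : s ≢ k
  s≢k refl = subst T ps pk

<firstTrue : ∀ p d {s x k} → (∀ {j} → j ≤ k → ¬ T (p j)) → k < x → k < firstTrue p d s x
<firstTrue p zero    _  k<x = k<x
<firstTrue p (suc d) {s} ¬p k<x with p s in ps
... | true  = ≰⇒> (λ s≤k → ¬p s≤k (subst T (sym ps) tt))
... | false = <firstTrue p d ¬p k<x

firstTrue-default : ∀ p d {s j} x y → s ≤ j → j < s + d → T (p j) → firstTrue p d s x ≡ firstTrue p d s y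
firstTrue-default p zero    {s} x y s≤j j<s+0 _ = ⊥-elim (<⇒≱ (subst (_ <_) (+-identityʳ s) j<s+0) s≤j)
firstTrue-default p (suc d) {s} {j} x y s≤j j<s+d pj with p s in ps
... | true  = refl
... | false = firstTrue-default p d x y (≤∧≢⇒< s≤j s≢j) (subst (j <_) (+-suc s d) j<s+d) pj
  where
  s≢j : s ≢ j
  s≢j refl = subst T ps pj

distinct⇒1<n : ∀ {n} {u v : Fin n} → u ≢ v → 1 < n
distinct⇒1<n {suc (suc n)}              _   = s≤s (s≤s z≤n)
distinct⇒1<n {suc zero} {zero} {zero} u≢v = ⊥-elim (u≢v refl)

other-vertex : ∀ {n} → 1 < n → (v : Fin n) → ∃ λ w → w ≢ v
other-vertex {suc zero}    (s≤s ()) _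
other-vertex {suc (suc n)} _        v = punchIn v zero , punchInᵢ≢i v zero

-- dist runs a search, private to Defs, over the radii 0 … n - 1 and cannot be unfolded for a
-- symbolic n; once v is reachable from u in three steps, its first four steps determine it.
dist≡firstTrue : ∀ {n} (G : Graph n) {u v} → T (reachWithin G 3 u v) →
                 dist G u v ≡ firstTrue (λ k → reachWithin G k u v) (4 ⊓ n) 0 (4 ⊓ n)
dist≡firstTrue {suc zero}                   G _ = refl
dist≡firstTrue {suc (suc zero)}             G _ = refl
dist≡firstTrue {suc (suc (suc zero))}       G _ = refl
dist≡firstTrue {suc (suc (suc (suc n)))} G {u} {v} r₃ =
  firstTrue-default (λ k → reachWithin G k u v) 4 _ 4 z≤n (s≤s (s≤s (s≤s (s≤s z≤n)))) r₃

module GraphFacts {n : ℕ} (G : Graph n) where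

  infix 4 _∼_
  -- records rather than T (…), so that the vertices can be inferred from a proof
  record _∼_ (u v : Fin n) : Set where
    constructor edge
    field isEdge : T (adj G u v)
  open _∼_ public

  _∼?_ : ∀ u v → Dec (u ∼ v)
  u ∼? v = map′ edge isEdge (T? (adj G u v))

  ∼-sym : ∀ {u v} → u ∼ v → v ∼ u
  ∼-sym {u} {v} (edge e) = edge (subst T (adj-sym G u v) e)

  ∼⇒≢ : ∀ {u v} → u ∼ v → u ≢ v
  ∼⇒≢ {u} (edge e) refl = subst T (adj-irrefl G u) e

  ∈-nbrs⁺ : ∀ {u w} → u ∼ w → w ∈ nbrs G u
  ∈-nbrs⁺ {u} {w} (edge e) = ∈-filter⁺ (T? ∘ adj G u) (∈-allFin w) e

  ∈-nbrs⁻ : ∀ {u w} → w ∈ nbrs G u → u ∼ w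
  ∈-nbrs⁻ {u} w∈ = edge (proj₂ (∈-filter⁻ (T? ∘ adj G u) {xs = allFin n} w∈))

  nbrs-unique : ∀ u → Unique (nbrs G u)
  nbrs-unique u = filter⁺ (T? ∘ adj G u) (allFin⁺ n)

  record Reach (k : ℕ) (u v : Fin n) : Set where
    constructor within
    field isWithin : T (reachWithin G k u v)
  open Reach public

  reach-zero : ∀ {u} → Reach 0 u u
  reach-zero {u} = within (≡⇒≡ᵇ (toℕ u) (toℕ u) refl)

  reach-zero⁻ : ∀ {u v} → Reach 0 u v → u ≡ v
  reach-zero⁻ {u} {v} (within r) = toℕ-injective (≡ᵇ⇒≡ (toℕ u) (toℕ v) r)

  reach-suc : ∀ {k u v} → Reach k u v → Reach (suc k) u v
  reach-suc (within r) = within (from T-∨ (inj₁ r))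

  reach-step : ∀ {k u w v} → u ∼ w → Reach k w v → Reach (suc k) u v
  reach-step {w = w} (edge e) (within r) =
    within (from T-∨ (inj₂ (any⁺ _ (lose (∈-allFin w) (from T-∧ (e , r))))))

  reach-suc⁻ : ∀ {k u v} → Reach (suc k) u v → Reach k u v ⊎ ∃ λ w → u ∼ w × Reach k w v
  reach-suc⁻ (within r) with to T-∨ r
  ... | inj₁ r′ = inj₁ (within r′)
  ... | inj₂ a with w , _ , e∧r ← find (any⁻ _ (allFin n) a) with e , r′ ← to T-∧ e∧r =
    inj₂ (w , edge e , within r′)

  reach-mono : ∀ {j k u v} → j ≤ k → Reach j u v → Reach k u v
  reach-mono j≤k = go (≤⇒≤′ j≤k)
    where
    go : ∀ {j k u v} → j ≤′ k → Reach j u v → Reach k u v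
    go ≤′-refl       r = r
    go (≤′-step j≤k) r = reach-suc (go j≤k r)

  reach-++ : ∀ j {k u w v} → Reach j u w → Reach k w v → Reach (j + k) u v
  reach-++ zero {k} {v = v} r s = subst (λ x → Reach k x v) (sym (reach-zero⁻ r)) s
  reach-++ (suc j) r s with reach-suc⁻ r
  ... | inj₁ r′               = reach-suc (reach-++ j r′ s)
  ... | inj₂ (_ , u∼u′ , r′) = reach-step u∼u′ (reach-++ j r′ s)

  reach-adj : ∀ {u v} → u ∼ v → Reach 1 u v
  reach-adj u∼v = reach-step u∼v reach-zero

  reach-one⁺ : ∀ {u v} → (u ≢ v → u ∼ v) → Reach 1 u v
  reach-one⁺ {u} {v} ∼-if-≢ with u F.≟ v
  ... | yes refl = reach-suc reach-zero
  ... | no  u≢v  = reach-adj (∼-if-≢ u≢v)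

  reach-one⁻ : ∀ {u v} → Reach 1 u v → u ≡ v ⊎ u ∼ v
  reach-one⁻ r with reach-suc⁻ r
  ... | inj₁ r₀              = inj₁ (reach-zero⁻ r₀)
  ... | inj₂ (_ , u∼w , r₀) = inj₂ (subst (_ ∼_) (reach-zero⁻ r₀) u∼w)

  reach-two⁻ : ∀ {u v} → Reach 2 u v → u ≡ v ⊎ u ∼ v ⊎ ∃ λ w → u ∼ w × w ∼ v
  reach-two⁻ r with reach-suc⁻ r
  ... | inj₁ r₁ = map₂ inj₁ (reach-one⁻ r₁)
  ... | inj₂ (w , u∼w , r₁) with reach-one⁻ r₁
  ...   | inj₁ refl = inj₂ (inj₁ u∼w)
  ...   | inj₂ w∼v  = inj₂ (inj₂ (w , u∼w , w∼v))

  dist≤ : ∀ {k u v} → k ≤ 3 → Reach k u v → dist G u v ≤ k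
  dist≤ {k} k≤3 r = subst (_≤ k) (sym (dist≡firstTrue G (isWithin (reach-mono k≤3 r))))
                          (firstTrue≤ _ (4 ⊓ n) (λ 4⊓n≤k → 4⊓n≤k) z≤n (isWithin r))

  <dist : ∀ {k u v} → k < n → Reach 3 u v → ¬ Reach k u v → k < dist G u v
  <dist {k} {u} {v} k<n r₃ ¬r = subst (k <_) (sym (dist≡firstTrue G (isWithin r₃)))
                                      (<firstTrue _ (4 ⊓ n) ¬r≤k (⊓-glb k<4 k<n))
    where
    ¬r≤k : ∀ {j} → j ≤ k → ¬ T (reachWithin G j u v)
    ¬r≤k j≤k r = ¬r (reach-mono j≤k (within r))
    k<4 : k < 4
    k<4 = ≰⇒> (λ 4≤k → ¬r (reach-mono (≤-trans (n≤1+n 3) 4≤k) r₃))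

  dist-refl : ∀ {u} → dist G u u ≡ 0
  dist-refl = n≤0⇒n≡0 (dist≤ z≤n reach-zero)

  dist≤1 : ∀ {u v} → u ∼ v → dist G u v ≤ 1
  dist≤1 u∼v = dist≤ (s≤s z≤n) (reach-adj u∼v)

  dist≤2 : ∀ {u w v} → u ∼ w → w ∼ v → dist G u v ≤ 2
  dist≤2 u∼w w∼v = dist≤ (s≤s (s≤s z≤n)) (reach-++ 1 (reach-adj u∼w) (reach-adj w∼v))

  1≤dist : ∀ {u v} → Reach 3 u v → u ≢ v → 1 ≤ dist G u v
  1≤dist {u} r₃ u≢v = <dist (≤-trans (s≤s z≤n) (toℕ<n u)) r₃ (u≢v ∘ reach-zero⁻)

  2≤dist : ∀ {u v} → Reach 3 u v → u ≢ v → ¬ u ∼ v → 2 ≤ dist G u v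
  2≤dist r₃ u≢v ¬u∼v = <dist (distinct⇒1<n u≢v) r₃ ([ u≢v , ¬u∼v ]′ ∘ reach-one⁻)

  3≤dist : ∀ {u v} → 2 < n → Reach 3 u v → u ≢ v → ¬ u ∼ v → (∀ w → u ∼ w → ¬ w ∼ v) → 3 ≤ dist G u v
  3≤dist 2<n r₃ u≢v ¬u∼v no-common =
    <dist 2<n r₃ ([ u≢v , [ ¬u∼v , (λ (w , u∼w , w∼v) → no-common w u∼w w∼v) ]′ ]′ ∘ reach-two⁻)

  dist≤ecc : ∀ v w → dist G v w ≤ ecc G v
  dist≤ecc v w = ≤-foldr-⊔ (dist G v) (allFin n) (∈-allFin w)

  ecc≤ : ∀ {k} v → (∀ w → dist G v w ≤ k) → ecc G v ≤ k
  ecc≤ v ub = foldr-⊔-≤ (dist G v) (allFin n) (λ {w} _ → ub w)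

  Universal : Fin n → Set
  Universal v = ∀ w → w ≢ v → v ∼ w

  universal? : ∀ v → Dec (Universal v)
  universal? v = all? (λ w → ¬? (w F.≟ v) →-dec v ∼? w)

  ¬universal⇒ : ∀ {v} → ¬ Universal v → ∃ λ w → w ≢ v × ¬ v ∼ w
  ¬universal⇒ {v} ¬univ with w , ¬edge ← ¬∀⟶∃¬ n _ (λ w → ¬? (w F.≟ v) →-dec v ∼? w) ¬univ =
    w , (λ w≡v → ¬edge (λ w≢v → ⊥-elim (w≢v w≡v))) , (λ v∼w → ¬edge (λ _ → v∼w))

  ecc≡1⇒∼ : ∀ {v w} → ecc G v ≡ 1 → w ≢ v → Reach 3 v w → v ∼ w
  ecc≡1⇒∼ {v} {w} ecc≡1 w≢v r₃ with v ∼? w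
  ... | yes v∼w = v∼w
  ... | no ¬v∼w = ⊥-elim (1+n≰n (≤-trans (2≤dist r₃ (≢-sym w≢v) ¬v∼w)
                                          (subst (dist G v w ≤_) ecc≡1 (dist≤ecc v w))))

  universal⇒ecc≡1 : ∀ {v} → 1 < n → Universal v → ecc G v ≡ 1
  universal⇒ecc≡1 {v} 1<n universal with w , w≢v ← other-vertex 1<n v =
    ≤-antisym (ecc≤ v dist≤1-from-v)
              (≤-trans (1≤dist (reach-mono (s≤s z≤n) (reach-adj (universal w w≢v))) (≢-sym w≢v)) (dist≤ecc v w))
    where
    dist≤1-from-v : ∀ x → dist G v x ≤ 1
    dist≤1-from-v x with x F.≟ v
    ... | yes refl = subst (_≤ 1) (sym dist-refl) z≤n
    ... | no x≢v   = dist≤1 (universal x x≢v)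

  NeighboursCloser : Fin n → Fin n → Set
  NeighboursCloser v u = sum (map (λ w → dist G w u) (nbrs G v)) < deg G v * dist G v u

  closer⇒≢ : ∀ {v u} → NeighboursCloser v u → u ≢ v
  closer⇒≢ {v} closer refl =
    n≮0 (subst (sum (map (λ w → dist G w v) (nbrs G v)) <_)
               (trans (cong (deg G v *_) dist-refl) (*-zeroʳ (deg G v))) closer)

  -- the neighbour x contributes 0, the neighbour y at least 2, every other neighbour at least 1
  ¬closer-to-neighbour : ∀ {v x y} → (∀ w → Reach 3 w x) → v ∼ x → v ∼ y → y ≢ x → ¬ y ∼ x →
                         ¬ NeighboursCloser v x
  ¬closer-to-neighbour {v} {x} {y} reach-x v∼x v∼y y≢x ¬y∼x closer =
    ≤⇒≯ deg≤sum (<-≤-trans closer (*-monoʳ-≤ (deg G v) (dist≤1 v∼x)))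
    where
    deg≤sum : deg G v * 1 ≤ sum (map (λ w → dist G w x) (nbrs G v))
    deg≤sum = length*≤sum-pair (λ w → dist G w x) (nbrs G v) (nbrs-unique v)
      (∈-nbrs⁺ v∼x) (∈-nbrs⁺ v∼y) (≢-sym y≢x)
      (subst (λ d → 2 ≤ d + dist G y x) (sym dist-refl) (2≤dist (reach-x y) y≢x ¬y∼x))
      (λ {w} _ w≢x _ → 1≤dist (reach-x w) w≢x)

module Dense {n : ℕ} (G : Graph n) (1<n : 1 < n) (dense : ∀ v → n ≤ 2 * deg G v + 1) where
  open GraphFacts G

  common-neighbour : ∀ {u v} → u ≢ v → ¬ u ∼ v → ∃ λ w → u ∼ w × w ∼ v
  common-neighbour {u} {v} u≢v ¬u∼v with any? (λ w → u ∼? w ×-dec w ∼? v)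
  ... | yes found = found
  ... | no  none  = ⊥-elim (<-irrefl refl (begin-strict
        n                                ≤⟨ sum-of-halves {a = deg G u} {deg G v} (dense u) (dense v) ⟩
        deg G u + deg G v + 1            ≤⟨ +-monoʳ-≤ (deg G u + deg G v)
                                                (filter-some (T? ∘ is-u) (lose (∈-allFin u) u≡u)) ⟩
        deg G u + deg G v + length singleton-u     ≡⟨ +-assoc (deg G u) _ _ ⟩
        deg G u + (deg G v + length singleton-u)   ≡⟨ counts ⟨
        length (filterᵇ covered (allFin n)) <⟨ filter-notAll (T? ∘ covered) (allFin n)
                                                   (lose (∈-allFin v) v∉covered) ⟩
        length (allFin n)                ≡⟨ length-tabulate id ⟩
        n                                ∎))
    where
    open ≤-Reasoning
    is-u : Fin n → Bool
    is-u w = isYes (w F.≟ u)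
    u≡u : T (is-u u)
    u≡u = fromWitness {a? = u F.≟ u} refl
    singleton-u = filterᵇ is-u (allFin n)
    covered : Fin n → Bool
    covered w = adj G u w ∨ (adj G v w ∨ is-u w)
    v∉covered : ¬ T (covered v)
    v∉covered t with to T-∨ t
    ... | inj₁ e = ¬u∼v (edge e)
    ... | inj₂ t′ with to T-∨ t′
    ...   | inj₁ e = ∼⇒≢ (edge e) refl
    ...   | inj₂ e = u≢v (sym (toWitness {a? = v F.≟ u} e))
    counts : length (filterᵇ covered (allFin n)) ≡ deg G u + (deg G v + length singleton-u)
    counts = trans (length-filterᵇ-∨ (adj G u) _ disjoint-u (allFin n))
                   (cong (deg G u +_) (length-filterᵇ-∨ (adj G v) is-u disjoint-v (allFin n)))
      where
      disjoint-v : ∀ w → T (adj G v w) → ¬ T (is-u w)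
      disjoint-v w e w≡u with refl ← toWitness {a? = w F.≟ u} w≡u = ¬u∼v (∼-sym (edge e))
      disjoint-u : ∀ w → T (adj G u w) → ¬ T (adj G v w ∨ is-u w)
      disjoint-u w e t with to T-∨ t
      ... | inj₁ e′  = none (w , edge e , ∼-sym (edge e′))
      ... | inj₂ w≡u with refl ← toWitness {a? = w F.≟ u} w≡u = ∼⇒≢ (edge e) refl

  reach₂ : ∀ u v → Reach 2 u v
  reach₂ u v with u F.≟ v
  ... | yes refl = reach-mono z≤n reach-zero
  ... | no u≢v with u ∼? v
  ...   | yes u∼v = reach-suc (reach-adj u∼v)
  ...   | no ¬u∼v with w , u∼w , w∼v ← common-neighbour u≢v ¬u∼v = reach-++ 1 (reach-adj u∼w) (reach-adj w∼v)

  reach₃ : ∀ u v → Reach 3 u v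
  reach₃ u v = reach-suc (reach₂ u v)

  diameter≤2 : ∀ u v → dist G u v ≤ 2
  diameter≤2 u v = dist≤ (s≤s (s≤s z≤n)) (reach₂ u v)

  ecc≡1⇔universal : ∀ {v} → ecc G v ≡ 1 ⇔ Universal v
  ecc≡1⇔universal {v} = mk⇔ (λ ecc≡1 w w≢v → ecc≡1⇒∼ ecc≡1 w≢v (reach₃ v w)) (universal⇒ecc≡1 1<n)

  ∂-nonuniversal : ∀ {v w} → w ≢ v → ¬ v ∼ w → InBoundary G v
  ∂-nonuniversal {v} {w} w≢v ¬v∼w with c , v∼c , c∼w ← common-neighbour (≢-sym w≢v) ¬v∼w =
    inj₂ (w , (begin-strict
      sum (map (λ y → dist G y w) (nbrs G v)) <⟨ sum<length* (λ y → dist G y w) (nbrs G v)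
                                                    (λ {y} _ → diameter≤2 y w) (∈-nbrs⁺ v∼c) (s≤s (dist≤1 c∼w)) ⟩
      deg G v * 2                             ≤⟨ *-monoʳ-≤ (deg G v) (2≤dist (reach₃ v w) (≢-sym w≢v) ¬v∼w) ⟩
      deg G v * dist G v w                    ∎))
    where open ≤-Reasoning

  ∂-universal-pair : ∀ {v x} → Universal v → Universal x → x ≢ v → InBoundary G v
  ∂-universal-pair {v} {x} univ-v univ-x x≢v = inj₂ (x , (begin-strict
      sum (map (λ y → dist G y x) (nbrs G v)) <⟨ sum<length* (λ y → dist G y x) (nbrs G v) dist≤1-to-x
                                                    (∈-nbrs⁺ (univ-v x x≢v)) (subst (_< 1) (sym dist-refl) (s≤s z≤n)) ⟩
      deg G v * 1                             ≤⟨ *-monoʳ-≤ (deg G v) (1≤dist (reach₃ v x) (≢-sym x≢v)) ⟩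
      deg G v * dist G v x                    ∎))
    where
    open ≤-Reasoning
    dist≤1-to-x : ∀ {y} → y ∈ nbrs G v → dist G y x ≤ 1
    dist≤1-to-x {y} _ with y F.≟ x
    ... | yes refl = subst (_≤ 1) (sym dist-refl) z≤n
    ... | no y≢x   = dist≤1 (∼-sym (univ-x y y≢x))

  universal∈∂⇒other-universal : ∀ {v} → Universal v → InBoundary G v → ∃ λ x → x ≢ v × Universal x
  universal∈∂⇒other-universal _ (inj₁ n≡1) = ⊥-elim (<⇒≢ 1<n (sym n≡1))
  universal∈∂⇒other-universal {v} univ-v (inj₂ (x , closer)) with universal? x
  ... | yes univ-x = x , closer⇒≢ closer , univ-x
  ... | no ¬univ-x with y , y≢x , ¬x∼y ← ¬universal⇒ ¬univ-x =
    ⊥-elim (¬closer-to-neighbour (λ w → reach₃ w x) (univ-v x x≢v) (univ-v y y≢v) y≢x (¬x∼y ∘ ∼-sym) closer)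
    where
    x≢v = closer⇒≢ closer
    y≢v : y ≢ v
    y≢v refl = ¬x∼y (∼-sym (univ-v x x≢v))

  ∂⇔≢-unique-universal : ∀ {u} → Universal u → (∀ w → Universal w → w ≡ u) →
                         ∀ v → InBoundary G v ⇔ (v ≢ u)
  ∂⇔≢-unique-universal {u} univ-u unique v = mk⇔ ∂⇒≢ ≢⇒∂
    where
    ∂⇒≢ : InBoundary G v → v ≢ u
    ∂⇒≢ ∂v refl with x , x≢v , univ-x ← universal∈∂⇒other-universal univ-u ∂v = x≢v (unique x univ-x)
    ≢⇒∂ : v ≢ u → InBoundary G v
    ≢⇒∂ v≢u with universal? v
    ... | yes univ-v = ⊥-elim (v≢u (unique v univ-v))
    ... | no ¬univ-v with w , w≢v , ¬v∼w ← ¬universal⇒ ¬univ-v = ∂-nonuniversal w≢v ¬v∼w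

  all-∂-unless-unique-universal : ¬ (∃ λ u → Universal u × (∀ w → Universal w → w ≡ u)) →
                                  ∀ v → InBoundary G v
  all-∂-unless-unique-universal no-unique v with universal? v
  ... | no ¬univ-v with w , w≢v , ¬v∼w ← ¬universal⇒ ¬univ-v = ∂-nonuniversal w≢v ¬v∼w
  ... | yes univ-v
    with w , ¬[univ-w⇒w≡v] ← ¬∀⟶∃¬ n _ (λ w → universal? w →-dec w F.≟ v)
                                      (λ unique → no-unique (v , univ-v , unique))
    with universal? w
  ...   | yes univ-w = ∂-universal-pair univ-v univ-w (λ w≡v → ¬[univ-w⇒w≡v] (λ _ → w≡v))
  ...   | no ¬univ-w = ⊥-elim (¬[univ-w⇒w≡v] (⊥-elim ∘ ¬univ-w))

dense-boundary : (n : ℕ) (G : Graph n) → Connected G → 2 ≤ n → (∀ v → n ≤ 2 * deg G v + 1) →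
  ((u : Fin n) → ecc G u ≡ 1 → (∀ w → ecc G w ≡ 1 → w ≡ u) → ∀ v → InBoundary G v ⇔ (v ≢ u))
  × (¬ (∃ λ u → ecc G u ≡ 1 × (∀ w → ecc G w ≡ 1 → w ≡ u)) → ∀ v → InBoundary G v)
dense-boundary n G _ 1<n dense =
  (λ u ecc≡1 unique →
     ∂⇔≢-unique-universal (to ecc≡1⇔universal ecc≡1) (λ w → unique w ∘ from ecc≡1⇔universal)) ,
  (λ no-unique → all-∂-unless-unique-universal (λ (u , univ-u , unique) →
     no-unique (u , from ecc≡1⇔universal univ-u , λ w → unique w ∘ to ecc≡1⇔universal)))
  where open Dense G 1<n dense

module Barbell (k : ℕ) where

  m : ℕ
  m = suc (suc k)

  open GraphFacts (barbell m)

  inClique isBridge adjℕ : ℕ → ℕ → Bool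
  inClique a b = not (eqᵇ a b) ∧ sameSide m a b
  isBridge a b = eqᵇ (suc a) m ∧ eqᵇ b m
  adjℕ a b     = inClique a b ∨ (isBridge a b ∨ isBridge b a)

  private
    <ᵇ-true : ∀ {a} → a < m → (a <ᵇ m) ≡ true
    <ᵇ-true a<m = to T-≡ (<⇒<ᵇ a<m)

    <ᵇ-false : ∀ {a} → m ≤ a → (a <ᵇ m) ≡ false
    <ᵇ-false {a} m≤a = to T-not-≡ (T-not⁺ (λ t → <⇒≱ (<ᵇ⇒< a m t) m≤a))

  adjℕ-clique : ∀ {a b} → a ≢ b → (a <ᵇ m) ≡ (b <ᵇ m) → T (adjℕ a b)
  adjℕ-clique {a} {b} a≢b same = from (T-∨ {inClique a b}) (inj₁ (from (T-∧ {not (eqᵇ a b)})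
    (T-not⁺ (a≢b ∘ ≡ᵇ⇒≡ a b) , subst T (sym (dec-true ((a <ᵇ m) B.≟ (b <ᵇ m)) same)) tt)))

  adjℕ-left : ∀ {a b} → a < m → b < m → a ≢ b → T (adjℕ a b)
  adjℕ-left a<m b<m a≢b = adjℕ-clique a≢b (trans (<ᵇ-true a<m) (sym (<ᵇ-true b<m)))

  adjℕ-right : ∀ {a b} → m ≤ a → m ≤ b → a ≢ b → T (adjℕ a b)
  adjℕ-right m≤a m≤b a≢b = adjℕ-clique a≢b (trans (<ᵇ-false m≤a) (sym (<ᵇ-false m≤b)))

  adjℕ-bridge : ∀ {a b} → suc a ≡ m → b ≡ m → T (adjℕ a b)
  adjℕ-bridge {a} {b} a+1≡m b≡m = from (T-∨ {inClique a b}) (inj₂ (from (T-∨ {isBridge a b}) (inj₁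
    (from (T-∧ {eqᵇ (suc a) m}) (≡⇒≡ᵇ (suc a) m a+1≡m , ≡⇒≡ᵇ b m b≡m)))))

  adjℕ-cross : ∀ {a b} → T (adjℕ a b) → a < m → m ≤ b → suc a ≡ m × b ≡ m
  adjℕ-cross {a} {b} t a<m m≤b with to (T-∨ {inClique a b}) t
  ... | inj₁ clique-edge = ⊥-elim (subst T (dec-false ((a <ᵇ m) B.≟ (b <ᵇ m)) sides-differ)
                                          (proj₂ (to (T-∧ {not (eqᵇ a b)}) clique-edge)))
    where
    sides-differ : (a <ᵇ m) ≢ (b <ᵇ m)
    sides-differ same = <⇒≱ (<ᵇ⇒< b m (subst T same (<⇒<ᵇ a<m))) m≤b
  ... | inj₂ bridge-edge with to (T-∨ {isBridge a b}) bridge-edge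
  ...   | inj₁ a→b = ≡ᵇ⇒≡ (suc a) m (proj₁ (to (T-∧ {eqᵇ (suc a) m}) a→b))
                   , ≡ᵇ⇒≡ b m (proj₂ (to (T-∧ {eqᵇ (suc a) m}) a→b))
  ...   | inj₂ b→a = ⊥-elim (<⇒≢ a<m (≡ᵇ⇒≡ a m (proj₂ (to (T-∧ {eqᵇ (suc b) m}) b→a))))

  left-∼ : ∀ {i j} → toℕ i < m → toℕ j < m → i ≢ j → i ∼ j
  left-∼ i<m j<m i≢j = edge (adjℕ-left i<m j<m (i≢j ∘ toℕ-injective))

  right-∼ : ∀ {i j} → m ≤ toℕ i → m ≤ toℕ j → i ≢ j → i ∼ j
  right-∼ m≤i m≤j i≢j = edge (adjℕ-right m≤i m≤j (i≢j ∘ toℕ-injective))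

  bridge-∼ : ∀ {i j} → suc (toℕ i) ≡ m → toℕ j ≡ m → i ∼ j
  bridge-∼ i+1≡m j≡m = edge (adjℕ-bridge i+1≡m j≡m)

  cross-∼ : ∀ {i j} → i ∼ j → toℕ i < m → m ≤ toℕ j → suc (toℕ i) ≡ m × toℕ j ≡ m
  cross-∼ (edge e) = adjℕ-cross e

  sides-≢ : ∀ {i j : Fin (m + m)} → toℕ i < m → m ≤ toℕ j → i ≢ j
  sides-≢ i<m m≤j refl = <⇒≱ i<m m≤j

  v₀ bₗ bᵣ far : Fin (m + m)
  v₀  = zero
  bₗ  = fromℕ< (m≤m+n m m)
  bᵣ  = fromℕ< (m<m+n m {m} z<s)
  far = fromℕ< (s≤s (s≤s (m≤n+m m k)))

  toℕ-bₗ : toℕ bₗ ≡ suc k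
  toℕ-bₗ = toℕ-fromℕ< (m≤m+n m m)

  toℕ-bᵣ : toℕ bᵣ ≡ m
  toℕ-bᵣ = toℕ-fromℕ< (m<m+n m {m} z<s)

  toℕ-far : toℕ far ≡ suc m
  toℕ-far = toℕ-fromℕ< (s≤s (s≤s (m≤n+m m k)))

  bₗ<m : toℕ bₗ < m
  bₗ<m = ≤-reflexive (cong suc toℕ-bₗ)

  m≤bᵣ : m ≤ toℕ bᵣ
  m≤bᵣ = ≤-reflexive (sym toℕ-bᵣ)

  bridge : bₗ ∼ bᵣ
  bridge = bridge-∼ (cong suc toℕ-bₗ) toℕ-bᵣ

  ¬∼-right-nonbridge : ∀ {i j} → toℕ i < m → m ≤ toℕ j → toℕ j ≢ m → ¬ i ∼ j
  ¬∼-right-nonbridge i<m m≤j j≢m i∼j = j≢m (proj₂ (cross-∼ i∼j i<m m≤j))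

  ¬∼-left-nonbridge : ∀ {i j} → toℕ i < m → suc (toℕ i) ≢ m → m ≤ toℕ j → ¬ i ∼ j
  ¬∼-left-nonbridge i<m i+1≢m m≤j i∼j = i+1≢m (proj₁ (cross-∼ i∼j i<m m≤j))

  reach₃ : ∀ i j → Reach 3 i j
  reach₃ i j with toℕ i <? m | toℕ j <? m
  ... | yes i<m | yes j<m = reach-mono (s≤s z≤n) (reach-one⁺ (left-∼ i<m j<m))
  ... | no  i≮m | no  j≮m = reach-mono (s≤s z≤n) (reach-one⁺ (right-∼ (≮⇒≥ i≮m) (≮⇒≥ j≮m)))
  ... | yes i<m | no  j≮m =
    reach-++ 2 (reach-++ 1 (reach-one⁺ (left-∼ i<m bₗ<m)) (reach-adj bridge))
               (reach-one⁺ (right-∼ m≤bᵣ (≮⇒≥ j≮m)))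
  ... | no  i≮m | yes j<m =
    reach-++ 2 (reach-++ 1 (reach-one⁺ (right-∼ (≮⇒≥ i≮m) m≤bᵣ)) (reach-adj (∼-sym bridge)))
               (reach-one⁺ (left-∼ bₗ<m j<m))

  deg≡count : ∀ i → deg (barbell m) i ≡ count (adjℕ (toℕ i)) (m + m)
  deg≡count i = length-filterᵇ-tabulate (adj (barbell m) i) id (adjℕ (toℕ i)) (λ _ → refl)

  left-degree right-degree : Fin (m + m) → ℕ
  left-degree  i = count (adjℕ (toℕ i)) m
  right-degree i = count (λ j → adjℕ (toℕ i) (m + j)) m

  deg≡left+right : ∀ i → deg (barbell m) i ≡ left-degree i + right-degree i
  deg≡left+right i = trans (deg≡count i) (count-+ (adjℕ (toℕ i)) m m)

  m∸1≤deg : ∀ i → m ∸ 1 ≤ deg (barbell m) i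
  m∸1≤deg i with toℕ i <? m
  ... | yes i<m = begin
    suc k                           ≤⟨ ≤-pred (count-except (adjℕ (toℕ i)) m (toℕ i)
                                                (λ j<m j≢i → adjℕ-left i<m j<m (≢-sym j≢i))) ⟩
    left-degree i                   ≤⟨ m≤m+n (left-degree i) (right-degree i) ⟩
    left-degree i + right-degree i  ≡⟨ deg≡left+right i ⟨
    deg (barbell m) i               ∎
    where open ≤-Reasoning
  ... | no i≮m = begin
    suc k                           ≤⟨ ≤-pred (count-except (λ j → adjℕ (toℕ i) (m + j)) m (toℕ i ∸ m)
                                                right-neighbour) ⟩
    right-degree i                  ≤⟨ m≤n+m (right-degree i) (left-degree i) ⟩
    left-degree i + right-degree i  ≡⟨ deg≡left+right i ⟨
    deg (barbell m) i               ∎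
    where
    open ≤-Reasoning
    right-neighbour : ∀ {j} → j < m → j ≢ toℕ i ∸ m → T (adjℕ (toℕ i) (m + j))
    right-neighbour {j} _ j≢i∸m = adjℕ-right (≮⇒≥ i≮m) (m≤m+n m j)
      (λ i≡m+j → j≢i∸m (sym (trans (cong (_∸ m) i≡m+j) (m+n∸m≡n m j))))

  deg-v₀ : deg (barbell m) v₀ ≡ m ∸ 1
  deg-v₀ = begin
    deg (barbell m) v₀                                               ≡⟨ deg≡count v₀ ⟩
    count (adjℕ 0 ∘ suc) (suc k + m)                                 ≡⟨ count-+ (adjℕ 0 ∘ suc) (suc k) m ⟩
    count (adjℕ 0 ∘ suc) (suc k) + count (λ j → adjℕ 0 (m + j)) m    ≡⟨ cong₂ _+_ left-clique no-bridge ⟩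
    suc k + 0                                                         ≡⟨ +-identityʳ (suc k) ⟩
    suc k                                                             ∎
    where
    open ≡-Reasoning
    left-clique = count-all (adjℕ 0 ∘ suc) (suc k) (λ j<k+1 → adjℕ-left z<s (s≤s j<k+1) (λ ()))
    no-bridge = count-none (λ j → adjℕ 0 (m + j)) m
                  (λ {j} _ t → case proj₁ (adjℕ-cross t z<s (m≤m+n m j)) of λ ())

  ecc≢1 : ∀ i → ecc (barbell m) i ≢ 1
  ecc≢1 i ecc≡1 with toℕ i <? m
  ... | yes i<m = ¬∼-right-nonbridge i<m m≤far far≢m (ecc≡1⇒∼ ecc≡1 (≢-sym (sides-≢ i<m m≤far)) (reach₃ i far))
    where
    m≤far : m ≤ toℕ far
    m≤far = ≤-trans (n≤1+n m) (≤-reflexive (sym toℕ-far))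
    far≢m : toℕ far ≢ m
    far≢m far≡m = 1+n≢n (trans (sym toℕ-far) far≡m)
  ... | no  i≮m = ¬∼-left-nonbridge {v₀} z<s (λ ()) (≮⇒≥ i≮m)
                    (∼-sym (ecc≡1⇒∼ ecc≡1 (sides-≢ z<s (≮⇒≥ i≮m)) (reach₃ i v₀)))

  3≤dist-nonbridges : ∀ {i j} → toℕ i < m → suc (toℕ i) ≢ m → m ≤ toℕ j → toℕ j ≢ m → 3 ≤ dist (barbell m) i j
  3≤dist-nonbridges {i} {j} i<m i+1≢m m≤j j≢m =
    3≤dist (s≤s (s≤s (≤-trans (s≤s z≤n) (m≤n+m m k)))) (reach₃ i j) (sides-≢ i<m m≤j)
           (¬∼-left-nonbridge i<m i+1≢m m≤j) no-common
    where
    no-common : ∀ c → i ∼ c → ¬ c ∼ j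
    no-common c i∼c c∼j with toℕ c <? m
    ... | yes c<m = ¬∼-right-nonbridge c<m m≤j j≢m c∼j
    ... | no  c≮m = ¬∼-left-nonbridge i<m i+1≢m (≮⇒≥ c≮m) i∼c

  bₗ≢v₀ : bₗ ≢ v₀
  bₗ≢v₀ bₗ≡v₀ = case trans (sym toℕ-bₗ) (cong toℕ bₗ≡v₀) of λ ()

  adjacent-not-closer : ∀ {x} → bₗ ∼ x → ¬ NeighboursCloser bₗ x
  adjacent-not-closer {x} bₗ∼x with toℕ x <? m
  ... | yes x<m = ¬closer-to-neighbour (λ w → reach₃ w x) bₗ∼x bridge (≢-sym (sides-≢ x<m m≤bᵣ))
                    (λ bᵣ∼x → ¬∼-left-nonbridge x<m x+1≢m m≤bᵣ (∼-sym bᵣ∼x))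
    where
    x+1≢m : suc (toℕ x) ≢ m
    x+1≢m x+1≡m = ∼⇒≢ bₗ∼x (toℕ-injective (trans toℕ-bₗ (sym (suc-injective x+1≡m))))
  ... | no  x≮m = ¬closer-to-neighbour (λ w → reach₃ w x) bₗ∼x (left-∼ bₗ<m z<s bₗ≢v₀) (sides-≢ z<s (≮⇒≥ x≮m))
                    (¬∼-left-nonbridge z<s (λ ()) (≮⇒≥ x≮m))

  -- x lies in the right clique, away from the bridge: bᵣ is at distance 1 from x, v₀ at distance 3
  -- and every other neighbour of bₗ at distance at least 2, so their mean is at least 2 ≥ d(bₗ, x)
  nonadjacent-not-closer : ∀ {x} → x ≢ bₗ → ¬ bₗ ∼ x → ¬ NeighboursCloser bₗ x
  nonadjacent-not-closer {x} x≢bₗ ¬bₗ∼x closer =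
    ≤⇒≯ 2deg≤sum (<-≤-trans closer (*-monoʳ-≤ (deg (barbell m) bₗ) (dist≤2 bridge (right-∼ m≤bᵣ m≤x bᵣ≢x))))
    where
    m≤x : m ≤ toℕ x
    m≤x = ≮⇒≥ (λ x<m → ¬bₗ∼x (left-∼ bₗ<m x<m (≢-sym x≢bₗ)))
    x≢m : toℕ x ≢ m
    x≢m x≡m = ¬bₗ∼x (bridge-∼ (cong suc toℕ-bₗ) x≡m)
    bᵣ≢x : bᵣ ≢ x
    bᵣ≢x refl = x≢m toℕ-bᵣ
    left-neighbour : ∀ {w} → w ∈ nbrs (barbell m) bₗ → w ≢ bᵣ → toℕ w < m
    left-neighbour {w} w∈ w≢bᵣ = ≰⇒> (λ m≤w →
      w≢bᵣ (toℕ-injective (trans (proj₂ (cross-∼ (∈-nbrs⁻ w∈) bₗ<m m≤w)) (sym toℕ-bᵣ))))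
    2deg≤sum : deg (barbell m) bₗ * 2 ≤ sum (map (λ w → dist (barbell m) w x) (nbrs (barbell m) bₗ))
    2deg≤sum = length*≤sum-pair (λ w → dist (barbell m) w x) (nbrs (barbell m) bₗ) (nbrs-unique bₗ)
      (∈-nbrs⁺ bridge) (∈-nbrs⁺ (left-∼ bₗ<m z<s bₗ≢v₀)) (≢-sym (sides-≢ z<s m≤bᵣ))
      (+-mono-≤ (1≤dist (reach₃ bᵣ x) bᵣ≢x) (3≤dist-nonbridges z<s (λ ()) m≤x x≢m))
      (λ {w} w∈ w≢bᵣ _ → let w<m = left-neighbour w∈ w≢bᵣ in
         2≤dist (reach₃ w x) (sides-≢ w<m m≤x) (¬∼-right-nonbridge w<m m≤x x≢m))

  bₗ∉∂ : ¬ InBoundary (barbell m) bₗ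
  bₗ∉∂ (inj₂ (x , closer)) with bₗ ∼? x
  ... | yes bₗ∼x = adjacent-not-closer bₗ∼x closer
  ... | no ¬bₗ∼x = nonadjacent-not-closer (closer⇒≢ closer) ¬bₗ∼x closer

barbell-sharp : (m : ℕ) → 2 ≤ m →
  ((∀ v → m ∸ 1 ≤ deg (barbell m) v) × (∃ λ v → deg (barbell m) v ≡ m ∸ 1))
  × (∀ v → ecc (barbell m) v ≢ 1)
  × (∃ λ v → ¬ InBoundary (barbell m) v)
barbell-sharp (suc (suc k)) (s≤s (s≤s z≤n)) = (m∸1≤deg , v₀ , deg-v₀) , ecc≢1 , bₗ , bₗ∉∂
  where open Barbell k

corollary5p3 :
    ((n : ℕ) (G : Graph n) → Connected G → 2 ≤ n → (∀ v → n ≤ 2 * deg G v + 1) →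
      ((u : Fin n) → ecc G u ≡ 1 → (∀ w → ecc G w ≡ 1 → w ≡ u) →
         ∀ v → InBoundary G v ⇔ (v ≢ u))
      × (¬ (∃ λ u → ecc G u ≡ 1 × (∀ w → ecc G w ≡ 1 → w ≡ u)) →
         ∀ v → InBoundary G v))
    × ((m : ℕ) → 2 ≤ m →
      ((∀ v → m ∸ 1 ≤ deg (barbell m) v) × (∃ λ v → deg (barbell m) v ≡ m ∸ 1))
      × (∀ v → ecc (barbell m) v ≢ 1)
      × (∃ λ v → ¬ InBoundary (barbell m) v))
corollary5p3 = dense-boundary , barbell-sharp
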